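{- Let $\mathbf{A}\in\mathbb{RL}^B$. The lattice of congruences of $\mathbf{A}$ (as an $\mathbb{RL}^B$-algebra) is isomorphic to the lattice of $\mathbb{RL}^B$-filters of $\mathbf{A}$. Specifically, the map $f$ sending a congruence $\equiv$ to $F_{\equiv}=\{a\in A: a\equiv 1\}$ is an isomorphism, whose inverse sends an $\mathbb{RL}^B$-filter $F$ to the congruence $\equiv_F$ defined by $a\equiv_F b$ iff $a\to b\in F$ and $b\to a\in F$.
   Context: A residuated lattice is an algebra $(A;\wedge,\vee,\cdot,\to,0,1)$ with $(A;\wedge,\vee,0,1)$ a bounded lattice ($0$ least, $1$ greatest), $(A;\cdot,1)$ a commutative monoid, and $a\cdot b\le c$ iff $a\le b\to c$; $\neg a=a\to0$. $\mathbb{RL}^B$ is the class of residuated lattices expanded with a unary operation $B$ such that $Ba\le a$, $Ba\vee\neg Ba=1$, and $b\le Ba$ whenever $b\le a$ and $b\vee\neg b=1$. An $\mathbb{RL}^B$-filter of $\mathbf{A}\in\mathbb{RL}^B$ is a set $F\subseteq A$ such that: $1\in F$; if $a\in F$ and $a\le b$ then $b\in F$; if $a,b\in F$ then $a\cdot b\in F$; if $a\in F$ then $Ba\in F$. Congruences are equivalence relations compatible with all operations $\wedge,\vee,\cdot,\to,B$. -}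

module Defs where

open import Level using (Level; _⊔_; suc)
open import Data.Product using (_×_)
open import Relation.Binary.PropositionalEquality using (_≡_)
open import Relation.Binary.Structures using (IsEquivalence)
open import Algebra.Lattice.Structures using (IsLattice)
open import Algebra.Structures using (IsCommutativeMonoid)
open import Function.Bundles using (_⇔_)

-- Residuated lattices expanded with the operation B (the class RL^B).
-- Equality is propositional equality on the carrier; the lattice order is
-- x ≤ y :⇔ x ∧ y ≡ x.
record RLB (a : Level) : Set (suc a) where
  infixr 7 _·_
  infixr 5 _⇒_
  infixr 6 _∧_
  infixr 6 _∨_
  field
    Carrier : Set a
    _∧_ _∨_ _·_ _⇒_ : Carrier → Carrier → Carrier
    𝟘 𝟙 : Carrier
    B : Carrier → Carrier
    isLattice : IsLattice _≡_ _∨_ _∧_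
    𝟘-least : ∀ x → 𝟘 ∧ x ≡ 𝟘
    𝟙-greatest : ∀ x → x ∧ 𝟙 ≡ x
    ·-isCommutativeMonoid : IsCommutativeMonoid _≡_ _·_ 𝟙
    residuation : ∀ x y z → (((x · y) ∧ z ≡ x · y) ⇔ (x ∧ (y ⇒ z) ≡ x))
    B-deflationary : ∀ x → B x ∧ x ≡ B x
    B-complemented : ∀ x → B x ∨ (B x ⇒ 𝟘) ≡ 𝟙
    B-greatest : ∀ x y → y ∧ x ≡ y → y ∨ (y ⇒ 𝟘) ≡ 𝟙 → y ∧ B x ≡ y

  infix 4 _≤_
  _≤_ : Carrier → Carrier → Set a
  x ≤ y = x ∧ y ≡ x

  ¬_ : Carrier → Carrier
  ¬ x = x ⇒ 𝟘

module _ {a : Level} (A : RLB a) where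
  open RLB A

  -- Congruences of A as an RL^B-algebra (compatible with ∧, ∨, ·, →, B;
  -- constants are trivially compatible).
  record IsCongruence {ℓ : Level} (θ : Carrier → Carrier → Set ℓ) : Set (a ⊔ ℓ) where
    field
      isEquivalence : IsEquivalence θ
      ∧-compat : ∀ {x y u v} → θ x y → θ u v → θ (x ∧ u) (y ∧ v)
      ∨-compat : ∀ {x y u v} → θ x y → θ u v → θ (x ∨ u) (y ∨ v)
      ·-compat : ∀ {x y u v} → θ x y → θ u v → θ (x · u) (y · v)
      ⇒-compat : ∀ {x y u v} → θ x y → θ u v → θ (x ⇒ u) (y ⇒ v)
      B-compat : ∀ {x y} → θ x y → θ (B x) (B y)

  record IsFilter {ℓ : Level} (F : Carrier → Set ℓ) : Set (a ⊔ ℓ) where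
    field
      𝟙∈F : F 𝟙
      up-closed : ∀ {x y} → F x → x ≤ y → F y
      ·-closed : ∀ {x y} → F x → F y → F (x · y)
      B-closed : ∀ {x} → F x → F (B x)

  filterOf : {ℓ : Level} → (Carrier → Carrier → Set ℓ) → Carrier → Set ℓ
  filterOf θ x = θ x 𝟙

  congOf : {ℓ : Level} → (Carrier → Set ℓ) → Carrier → Carrier → Set ℓ
  congOf F x y = F (x ⇒ y) × F (y ⇒ x)

-- An RL^B-filter is the 1-class of a congruence and conversely: the relation
-- "x ⇒ y and y ⇒ x lie in F" is compatible with every operation because each
-- compatibility reduces to an inequality of residuated lattices of the form
-- (x ⇒ y) · (u ⇒ v) ≤ s ⇒ t, and F is an upset closed under products. For B
-- the inequality is B (x ⇒ y) ≤ B x ⇒ B y, which holds since B x · B (x ⇒ y) is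
-- complemented and below y, so below B y by maximality of B. Conversely a
-- congruence is recovered from its 1-class because x ⇒ y ≈ 1 forces x ∧ y ≈ x.
module Submission where

open import Defs
open import Level using (Level)
open import Data.Product using (_×_; _,_)
open import Function.Bundles using (_⇔_; mk⇔; Equivalence)
open import Relation.Binary.PropositionalEquality
  using (_≡_; refl; sym; trans; cong; cong₂; subst; subst₂)
open import Relation.Binary.Structures using (IsEquivalence)
open import Algebra.Bundles using (CommutativeSemigroup)
open import Algebra.Lattice.Bundles using (Lattice)
open import Algebra.Lattice.Structures using (IsLattice)
open import Algebra.Structures using (IsCommutativeMonoid)
import Algebra.Lattice.Properties.Lattice as LatticeProperties
import Algebra.Properties.CommutativeSemigroup as CommutativeSemigroupProperties
import Relation.Binary.Lattice.Bundles as OrderTheoretic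
import Relation.Binary.Lattice.Properties.JoinSemilattice as JoinSemilatticeProperties

module ResiduatedLatticeProperties {a : Level} (A : RLB a) where
  open RLB A
  open IsCommutativeMonoid ·-isCommutativeMonoid
    using (comm; identityˡ; identityʳ; isCommutativeSemigroup)

  ·-commutativeSemigroup : CommutativeSemigroup a a
  ·-commutativeSemigroup = record { isCommutativeSemigroup = isCommutativeSemigroup }

  open CommutativeSemigroupProperties ·-commutativeSemigroup using (interchange; xy∙z≈xz∙y)

  lattice : Lattice a a
  lattice = record { isLattice = isLattice }

  -- The library orders a lattice by x ≡ x ∧ y, the symmetric form of our x ∧ y ≡ x.
  private
    module O = OrderTheoretic.Lattice (LatticeProperties.∨-∧-orderTheoreticLattice lattice)
    module OJ = JoinSemilatticeProperties O.joinSemilattice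

  ≤-refl : ∀ {x} → x ≤ x
  ≤-refl = sym O.refl

  ≤-trans : ∀ {x y z} → x ≤ y → y ≤ z → x ≤ z
  ≤-trans p q = sym (O.trans (sym p) (sym q))

  ≤-antisym : ∀ {x y} → x ≤ y → y ≤ x → x ≡ y
  ≤-antisym p q = O.antisym (sym p) (sym q)

  ≤-respˡ-≡ : ∀ {x y z} → x ≡ y → y ≤ z → x ≤ z
  ≤-respˡ-≡ refl p = p

  ≤-respʳ-≡ : ∀ {x y z} → y ≡ z → x ≤ y → x ≤ z
  ≤-respʳ-≡ refl p = p

  x≤x∨y : ∀ {x y} → x ≤ x ∨ y
  x≤x∨y {x} {y} = sym (O.x≤x∨y x y)

  y≤x∨y : ∀ {x y} → y ≤ x ∨ y
  y≤x∨y {x} {y} = sym (O.y≤x∨y x y)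

  ∨-least : ∀ {x y z} → x ≤ z → y ≤ z → x ∨ y ≤ z
  ∨-least p q = sym (O.∨-least (sym p) (sym q))

  x∧y≤x : ∀ {x y} → x ∧ y ≤ x
  x∧y≤x {x} {y} = sym (O.x∧y≤x x y)

  x∧y≤y : ∀ {x y} → x ∧ y ≤ y
  x∧y≤y {x} {y} = sym (O.x∧y≤y x y)

  ∧-greatest : ∀ {x y z} → x ≤ y → x ≤ z → x ≤ y ∧ z
  ∧-greatest p q = sym (O.∧-greatest (sym p) (sym q))

  x≤y⇒x∨y≡y : ∀ {x y} → x ≤ y → x ∨ y ≡ y
  x≤y⇒x∨y≡y p = OJ.x≤y⇒x∨y≈y (sym p)

  𝟙≤x⇒x≡𝟙 : ∀ {x} → 𝟙 ≤ x → x ≡ 𝟙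
  𝟙≤x⇒x≡𝟙 {x} = ≤-antisym (𝟙-greatest x)

  curry : ∀ {x y z} → x · y ≤ z → x ≤ y ⇒ z
  curry {x} {y} {z} = Equivalence.to (residuation x y z)

  uncurry : ∀ {x y z} → x ≤ y ⇒ z → x · y ≤ z
  uncurry {x} {y} {z} = Equivalence.from (residuation x y z)

  ⇒-eval : ∀ {x y} → (x ⇒ y) · x ≤ y
  ⇒-eval = uncurry ≤-refl

  x·[x⇒y]≤y : ∀ {x y} → x · (x ⇒ y) ≤ y
  x·[x⇒y]≤y {x} {y} = ≤-respˡ-≡ (comm x (x ⇒ y)) ⇒-eval

  ·-monoˡ-≤ : ∀ {x y z} → x ≤ y → x · z ≤ y · z
  ·-monoˡ-≤ p = uncurry (≤-trans p (curry ≤-refl))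

  ·-monoʳ-≤ : ∀ {x y z} → x ≤ y → z · x ≤ z · y
  ·-monoʳ-≤ {x} {y} {z} p = ≤-respˡ-≡ (comm z x) (≤-respʳ-≡ (comm y z) (·-monoˡ-≤ p))

  x·y≤x : ∀ {x y} → x · y ≤ x
  x·y≤x {x} {y} = ≤-respʳ-≡ (identityʳ x) (·-monoʳ-≤ (𝟙-greatest y))

  x·y≤y : ∀ {x y} → x · y ≤ y
  x·y≤y {x} {y} = ≤-respˡ-≡ (comm x y) x·y≤x

  [[x⇒y]·z]·x≤y : ∀ {x y z} → ((x ⇒ y) · z) · x ≤ y
  [[x⇒y]·z]·x≤y = ≤-trans (·-monoˡ-≤ x·y≤x) ⇒-eval

  [z·[x⇒y]]·x≤y : ∀ {x y z} → (z · (x ⇒ y)) · x ≤ y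
  [z·[x⇒y]]·x≤y = ≤-trans (·-monoˡ-≤ x·y≤y) ⇒-eval

  ∨-·-least : ∀ {x y z w} → x · z ≤ w → y · z ≤ w → (x ∨ y) · z ≤ w
  ∨-·-least p q = uncurry (∨-least (curry p) (curry q))

  ⇒-antitoneˡ : ∀ {x y z} → x ≤ y → y ⇒ z ≤ x ⇒ z
  ⇒-antitoneˡ p = curry (≤-trans (·-monoʳ-≤ p) ⇒-eval)

  ·-mono-≤ : ∀ {x y u v} → x ≤ y → u ≤ v → x · u ≤ y · v
  ·-mono-≤ p q = ≤-trans (·-monoˡ-≤ p) (·-monoʳ-≤ q)

  ·-∨-least : ∀ {x y z w} → z · x ≤ w → z · y ≤ w → z · (x ∨ y) ≤ w
  ·-∨-least {x} {y} {z} p q = ≤-respˡ-≡ (comm z (x ∨ y))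
    (∨-·-least (≤-respˡ-≡ (comm x z) p) (≤-respˡ-≡ (comm y z) q))

  x⇒x≡𝟙 : ∀ x → x ⇒ x ≡ 𝟙
  x⇒x≡𝟙 x = 𝟙≤x⇒x≡𝟙 (curry (≤-respˡ-≡ (identityˡ x) ≤-refl))

  x⇒𝟙≡𝟙 : ∀ x → x ⇒ 𝟙 ≡ 𝟙
  x⇒𝟙≡𝟙 x = 𝟙≤x⇒x≡𝟙 (curry (𝟙-greatest (𝟙 · x)))

  𝟙⇒x≡x : ∀ x → 𝟙 ⇒ x ≡ x
  𝟙⇒x≡x x = ≤-antisym
    (≤-respˡ-≡ (sym (identityʳ (𝟙 ⇒ x))) ⇒-eval)
    (curry (≤-respˡ-≡ (identityʳ x) ≤-refl))

  x·[x⇒y]≤x∧y : ∀ {x y} → x · (x ⇒ y) ≤ x ∧ y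
  x·[x⇒y]≤x∧y = ∧-greatest x·y≤x x·[x⇒y]≤y

  [x⇒y]·[y⇒z]≤x⇒z : ∀ {x y z} → (x ⇒ y) · (y ⇒ z) ≤ x ⇒ z
  [x⇒y]·[y⇒z]≤x⇒z {x} {y} {z} = curry (≤-respˡ-≡ (xy∙z≈xz∙y (x ⇒ y) (y ⇒ z) x)
    (≤-trans (·-monoˡ-≤ ⇒-eval) x·[x⇒y]≤y))

  [x⇒y]·[u⇒v]≤x∧u⇒y∧v : ∀ {x y u v} → (x ⇒ y) · (u ⇒ v) ≤ x ∧ u ⇒ y ∧ v
  [x⇒y]·[u⇒v]≤x∧u⇒y∧v = curry (∧-greatest
    (≤-trans (·-monoʳ-≤ x∧y≤x) [[x⇒y]·z]·x≤y)
    (≤-trans (·-monoʳ-≤ x∧y≤y) [z·[x⇒y]]·x≤y))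

  [x⇒y]·[u⇒v]≤x∨u⇒y∨v : ∀ {x y u v} → (x ⇒ y) · (u ⇒ v) ≤ x ∨ u ⇒ y ∨ v
  [x⇒y]·[u⇒v]≤x∨u⇒y∨v = curry (·-∨-least
    (≤-trans [[x⇒y]·z]·x≤y x≤x∨y)
    (≤-trans [z·[x⇒y]]·x≤y y≤x∨y))

  [x⇒y]·[u⇒v]≤x·u⇒y·v : ∀ {x y u v} → (x ⇒ y) · (u ⇒ v) ≤ x · u ⇒ y · v
  [x⇒y]·[u⇒v]≤x·u⇒y·v {x} {y} {u} {v} = curry (≤-respˡ-≡ (interchange (x ⇒ y) (u ⇒ v) x u)
    (·-mono-≤ ⇒-eval ⇒-eval))

  [y⇒x]·[u⇒v]≤[x⇒u]⇒y⇒v : ∀ {x y u v} → (y ⇒ x) · (u ⇒ v) ≤ (x ⇒ u) ⇒ y ⇒ v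
  [y⇒x]·[u⇒v]≤[x⇒u]⇒y⇒v {x} {y} {u} {v} = curry (≤-respˡ-≡ (xy∙z≈xz∙y (y ⇒ x) (u ⇒ v) (x ⇒ u))
    (≤-trans (·-monoˡ-≤ [x⇒y]·[y⇒z]≤x⇒z) [x⇒y]·[y⇒z]≤x⇒z))

  Complemented : Carrier → Set a
  Complemented x = x ∨ ¬ x ≡ 𝟙

  ·-complemented : ∀ {x y} → Complemented x → Complemented y → Complemented (x · y)
  ·-complemented {x} {y} cx cy = 𝟙≤x⇒x≡𝟙 (≤-respˡ-≡ (sym excluded-middle) cases)
    where
    excluded-middle : (x ∨ ¬ x) · (y ∨ ¬ y) ≡ 𝟙
    excluded-middle = trans (cong₂ _·_ cx cy) (identityˡ 𝟙)
    cases : (x ∨ ¬ x) · (y ∨ ¬ y) ≤ x · y ∨ ¬ (x · y)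
    cases = ∨-·-least
      (·-∨-least x≤x∨y (≤-trans (≤-trans x·y≤y (⇒-antitoneˡ x·y≤y)) y≤x∨y))
      (≤-trans (≤-trans x·y≤x (⇒-antitoneˡ x·y≤x)) y≤x∨y)

  B𝟙≡𝟙 : B 𝟙 ≡ 𝟙
  B𝟙≡𝟙 = 𝟙≤x⇒x≡𝟙 (B-greatest 𝟙 𝟙 ≤-refl (𝟙≤x⇒x≡𝟙 x≤x∨y))

  B[x⇒y]≤Bx⇒By : ∀ {x y} → B (x ⇒ y) ≤ B x ⇒ B y
  B[x⇒y]≤Bx⇒By {x} {y} = curry (B-greatest y (B (x ⇒ y) · B x)
    (≤-trans (·-mono-≤ (B-deflationary (x ⇒ y)) (B-deflationary x)) ⇒-eval)
    (·-complemented (B-complemented (x ⇒ y)) (B-complemented x)))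

module CongruenceFilterCorrespondence {a : Level} (A : RLB a) where
  open RLB A
  open IsLattice isLattice using (∧-comm; ∨-absorbs-∧)
  open IsCommutativeMonoid ·-isCommutativeMonoid using (identityˡ; identityʳ)
  open ResiduatedLatticeProperties A

  module _ {ℓ : Level} {F : Carrier → Set ℓ} (F-filter : IsFilter A F) where
    open IsFilter F-filter

    ∈-·-bound : ∀ {x y z} → F x → F y → x · y ≤ z → F z
    ∈-·-bound x∈F y∈F x·y≤z = up-closed (·-closed x∈F y∈F) x·y≤z

    x⇒x∈F : ∀ x → F (x ⇒ x)
    x⇒x∈F x = subst F (sym (x⇒x≡𝟙 x)) 𝟙∈F

    congOf-compat : (_∙_ : Carrier → Carrier → Carrier) →
                    (∀ {x y u v} → (x ⇒ y) · (u ⇒ v) ≤ x ∙ u ⇒ y ∙ v) →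
                    ∀ {x y u v} → congOf A F x y → congOf A F u v → congOf A F (x ∙ u) (y ∙ v)
    congOf-compat _ bound (x⇒y∈F , y⇒x∈F) (u⇒v∈F , v⇒u∈F) =
      ∈-·-bound x⇒y∈F u⇒v∈F bound , ∈-·-bound y⇒x∈F v⇒u∈F bound

    congOf-isCongruence : IsCongruence A (congOf A F)
    congOf-isCongruence = record
      { isEquivalence = record
        { refl  = x⇒x∈F _ , x⇒x∈F _
        ; sym   = λ (p , q) → q , p
        ; trans = λ (p , q) (r , s) → ∈-·-bound p r [x⇒y]·[y⇒z]≤x⇒z , ∈-·-bound s q [x⇒y]·[y⇒z]≤x⇒z
        }
      ; ∧-compat = congOf-compat _∧_ [x⇒y]·[u⇒v]≤x∧u⇒y∧v
      ; ∨-compat = congOf-compat _∨_ [x⇒y]·[u⇒v]≤x∨u⇒y∨v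
      ; ·-compat = congOf-compat _·_ [x⇒y]·[u⇒v]≤x·u⇒y·v
      ; ⇒-compat = λ (p , q) (r , s) →
          ∈-·-bound q r [y⇒x]·[u⇒v]≤[x⇒u]⇒y⇒v , ∈-·-bound p s [y⇒x]·[u⇒v]≤[x⇒u]⇒y⇒v
      ; B-compat = λ (p , q) →
          up-closed (B-closed p) B[x⇒y]≤Bx⇒By , up-closed (B-closed q) B[x⇒y]≤Bx⇒By
      }

    filterOf-congOf : ∀ x → filterOf A (congOf A F) x ⇔ F x
    filterOf-congOf x = mk⇔
      (λ (_ , 𝟙⇒x∈F) → subst F (𝟙⇒x≡x x) 𝟙⇒x∈F)
      (λ x∈F → subst F (sym (x⇒𝟙≡𝟙 x)) 𝟙∈F , subst F (sym (𝟙⇒x≡x x)) x∈F)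

  module _ {ℓ : Level} {_≈_ : Carrier → Carrier → Set ℓ} (≈-congruence : IsCongruence A _≈_) where
    open IsCongruence ≈-congruence
    open IsEquivalence isEquivalence renaming (refl to ≈-refl; sym to ≈-sym; trans to ≈-trans)

    filterOf-isFilter : IsFilter A (filterOf A _≈_)
    filterOf-isFilter = record
      { 𝟙∈F       = ≈-refl
      ; up-closed = λ x≈𝟙 x≤y → subst₂ _≈_ (x≤y⇒x∨y≡y x≤y) (𝟙≤x⇒x≡𝟙 x≤x∨y) (∨-compat x≈𝟙 ≈-refl)
      ; ·-closed  = λ x≈𝟙 y≈𝟙 → subst (_ ≈_) (identityˡ 𝟙) (·-compat x≈𝟙 y≈𝟙)
      ; B-closed  = λ x≈𝟙 → subst (_ ≈_) B𝟙≡𝟙 (B-compat x≈𝟙)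
      }

    -- x ∧ y = x · (x ⇒ y) ∨ (x ∧ y) ≈ x · 𝟙 ∨ (x ∧ y) = x
    x⇒y≈𝟙⇒x∧y≈x : ∀ {x y} → (x ⇒ y) ≈ 𝟙 → (x ∧ y) ≈ x
    x⇒y≈𝟙⇒x∧y≈x {x} {y} x⇒y≈𝟙 = subst₂ _≈_
      (x≤y⇒x∨y≡y x·[x⇒y]≤x∧y)
      (trans (cong (_∨ (x ∧ y)) (identityʳ x)) (∨-absorbs-∧ x y))
      (∨-compat (·-compat ≈-refl x⇒y≈𝟙) ≈-refl)

    x≈y⇒x⇒y≈𝟙 : ∀ {x y} → x ≈ y → (x ⇒ y) ≈ 𝟙
    x≈y⇒x⇒y≈𝟙 {y = y} x≈y = subst (_ ≈_) (x⇒x≡𝟙 y) (⇒-compat x≈y ≈-refl)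

    congOf-filterOf : ∀ x y → congOf A (filterOf A _≈_) x y ⇔ x ≈ y
    congOf-filterOf x y = mk⇔
      (λ (x⇒y≈𝟙 , y⇒x≈𝟙) → ≈-trans (≈-sym (x⇒y≈𝟙⇒x∧y≈x x⇒y≈𝟙))
                              (subst (_≈ y) (∧-comm y x) (x⇒y≈𝟙⇒x∧y≈x y⇒x≈𝟙)))
      (λ x≈y → x≈y⇒x⇒y≈𝟙 x≈y , x≈y⇒x⇒y≈𝟙 (≈-sym x≈y))

  filterOf-⊆⇔ : ∀ {ℓ} {θ ψ : Carrier → Carrier → Set ℓ} → IsCongruence A θ → IsCongruence A ψ →
                (∀ x y → θ x y → ψ x y) ⇔ (∀ x → filterOf A θ x → filterOf A ψ x)
  filterOf-⊆⇔ θ-congruence ψ-congruence = mk⇔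
    (λ θ⊆ψ x → θ⊆ψ x 𝟙)
    (λ Fθ⊆Fψ x y θxy →
      let x⇒y∈Fθ , y⇒x∈Fθ = Equivalence.from (congOf-filterOf θ-congruence x y) θxy
      in Equivalence.to (congOf-filterOf ψ-congruence x y) (Fθ⊆Fψ _ x⇒y∈Fθ , Fθ⊆Fψ _ y⇒x∈Fθ))

open CongruenceFilterCorrespondence

proposition11 : ∀ {a ℓ : Level} (A : RLB a) →
    (∀ (θ : RLB.Carrier A → RLB.Carrier A → Set ℓ) → IsCongruence A θ → IsFilter A (filterOf A θ))
    × (∀ (F : RLB.Carrier A → Set ℓ) → IsFilter A F → IsCongruence A (congOf A F))
    × (∀ (θ : RLB.Carrier A → RLB.Carrier A → Set ℓ) → IsCongruence A θ →
         ∀ x y → (congOf A (filterOf A θ) x y ⇔ θ x y))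
    × (∀ (F : RLB.Carrier A → Set ℓ) → IsFilter A F →
         ∀ x → (filterOf A (congOf A F) x ⇔ F x))
    × (∀ (θ ψ : RLB.Carrier A → RLB.Carrier A → Set ℓ) → IsCongruence A θ → IsCongruence A ψ →
         ((∀ x y → θ x y → ψ x y) ⇔ (∀ x → filterOf A θ x → filterOf A ψ x)))
proposition11 A =
    (λ _ → filterOf-isFilter A)
  , (λ _ → congOf-isCongruence A)
  , (λ _ → congOf-filterOf A)
  , (λ _ → filterOf-congOf A)
  , (λ _ _ → filterOf-⊆⇔ A)
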